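{- Let $G$ be a finite simple graph on the vertex set $V$. Then $\operatorname{ind-match}(G) = \operatorname{min-match}(G)$ if and only if there exist non-negative integers $\alpha, \beta, \gamma$ and a partition of $V$ into pairwise distinct vertices \[ V = \{ v_{i1}, v_{i2} : i = 1, \ldots, \alpha+\beta \} \sqcup \{ z_1, \ldots, z_\alpha \} \sqcup \{ w_1, \ldots, w_\gamma \} \] such that, writing $e_i = \{v_{i1}, v_{i2}\}$ for $i = 1, \ldots, \alpha+\beta$ and $e_i' = \{v_{i1}, z_i\}$ for $i = 1, \ldots, \alpha$, the edge set of $G$ is \[ E(G) = \{ e_i : 1 \le i \le \alpha+\beta \} \cup \{ e_i' : 1 \le i \le \alpha \} \cup E', \] where every edge in $E'$ is of one of the following forms: (i) an edge containing some $z_i$ ($1 \le i \le \alpha$); (ii) an edge consisting of an end vertex of some $e_i$ with $\alpha+1 \le i \le \alpha+\beta$ and some $w_j$ ($1 \le j \le \gamma$); (iii) an edge $\{v_{i1}, w_j\}$ with $1 \le i \le \alpha$ and $1 \le j \le \gamma$.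
   Context: All graphs are finite and simple (no loops, no multiple edges). A matching of $G$ is a set of pairwise disjoint edges; a maximal matching is a matching not properly contained in another matching. $\operatorname{min-match}(G)$ is the minimum cardinality of a maximal matching of $G$. Two edges $e, e'$ are $3$-disjoint if $e \cap e' = \emptyset$ and there is no edge $f$ with $e \cap f \neq \emptyset$ and $e' \cap f \neq \emptyset$; an induced matching is a set of pairwise $3$-disjoint edges, and $\operatorname{ind-match}(G)$ is the maximum cardinality of an induced matching of $G$. -}

module Defs where

open import Data.Nat using (ℕ; _+_; _≤_)
open import Data.Fin using (Fin; _↑ˡ_; _↑ʳ_)
open import Data.Product using (_×_; _,_; ∃; ∃-syntax; Σ)
open import Data.Sum using (_⊎_)
open import Data.List using (List; _∷_; length)
open import Data.List.Relation.Unary.All using (All)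
open import Data.List.Relation.Unary.AllPairs using (AllPairs)
open import Relation.Nullary using (¬_; Dec)
open import Relation.Binary.PropositionalEquality using (_≡_; _≢_)
open import Function.Bundles using (_↔_; Inverse)

record Graph (n : ℕ) : Set₁ where
  field
    Adj    : Fin n → Fin n → Set
    sym    : ∀ {x y} → Adj x y → Adj y x
    irrefl : ∀ {x} → ¬ Adj x x
    dec    : ∀ x y → Dec (Adj x y)
open Graph public

-- An (unordered) edge is represented by an ordered pair of its end vertices.
Pair : ℕ → Set
Pair n = Fin n × Fin n

module _ {n : ℕ} (G : Graph n) where

  IsEdge : Pair n → Set
  IsEdge (a , b) = Adj G a b

  Disjoint : Pair n → Pair n → Set
  Disjoint (a , b) (c , d) = (a ≢ c) × (a ≢ d) × (b ≢ c) × (b ≢ d)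

  Meets : Pair n → Pair n → Set
  Meets (a , b) (c , d) = (a ≡ c) ⊎ (a ≡ d) ⊎ (b ≡ c) ⊎ (b ≡ d)

  -- a matching: a list of edges of G that are pairwise disjoint
  -- (so the list has no repetitions and its length is the cardinality)
  IsMatching : List (Pair n) → Set
  IsMatching M = All IsEdge M × AllPairs Disjoint M

  IsMaximalMatching : List (Pair n) → Set
  IsMaximalMatching M =
    IsMatching M × (∀ e → IsEdge e → ¬ IsMatching (e ∷ M))

  ThreeDisjoint : Pair n → Pair n → Set
  ThreeDisjoint e e' =
    Disjoint e e' × (∀ f → IsEdge f → ¬ (Meets e f × Meets e' f))

  IsInducedMatching : List (Pair n) → Set
  IsInducedMatching M = All IsEdge M × AllPairs ThreeDisjoint M

  IndMatchIs : ℕ → Set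
  IndMatchIs k =
    (∃[ M ] (IsInducedMatching M × length M ≡ k))
    × (∀ M → IsInducedMatching M → length M ≤ k)

  MinMatchIs : ℕ → Set
  MinMatchIs k =
    (∃[ M ] (IsMaximalMatching M × length M ≡ k))
    × (∀ M → IsMaximalMatching M → k ≤ length M)

  SamePair : Fin n → Fin n → Fin n → Fin n → Set
  SamePair x y a b = ((x ≡ a) × (y ≡ b)) ⊎ ((x ≡ b) × (y ≡ a))

  -- The structure of Theorem 2.3.  Indices i = 1..α+β are Fin (α + β);
  -- i ≤ α corresponds to (i ↑ˡ β) with i : Fin α, and α+1 ≤ i ≤ α+β
  -- corresponds to (α ↑ʳ j) with j : Fin β.
  -- The partition of V is a bijection
  --   (Fin (α+β) ⊎ Fin (α+β)) ⊎ (Fin α ⊎ Fin γ)  ↔  Fin n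
  -- sending inj₁ (inj₁ i) ↦ v_{i1}, inj₁ (inj₂ i) ↦ v_{i2},
  -- inj₂ (inj₁ i) ↦ z_i, inj₂ (inj₂ j) ↦ w_j.
  record Structure (α β γ : ℕ) : Set where
    field
      partition : ((Fin (α + β) ⊎ Fin (α + β)) ⊎ (Fin α ⊎ Fin γ)) ↔ Fin n
    open Inverse partition using (to)
    v1 : Fin (α + β) → Fin n
    v1 i = to (Data.Sum.inj₁ (Data.Sum.inj₁ i))
    v2 : Fin (α + β) → Fin n
    v2 i = to (Data.Sum.inj₁ (Data.Sum.inj₂ i))
    z : Fin α → Fin n
    z i = to (Data.Sum.inj₂ (Data.Sum.inj₁ i))
    w : Fin γ → Fin n
    w j = to (Data.Sum.inj₂ (Data.Sum.inj₂ j))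

    IsE : Fin n → Fin n → Set
    IsE x y = ∃[ i ] SamePair x y (v1 i) (v2 i)
    IsE' : Fin n → Fin n → Set
    IsE' x y = ∃[ i ] SamePair x y (v1 (i ↑ˡ β)) (z i)
    FormI : Fin n → Fin n → Set
    FormI x y = ∃[ i ] ((x ≡ z i) ⊎ (y ≡ z i))
    FormII : Fin n → Fin n → Set
    FormII x y = ∃[ i ] ∃[ j ]
      (SamePair x y (v1 (α ↑ʳ i)) (w j) ⊎ SamePair x y (v2 (α ↑ʳ i)) (w j))
    FormIII : Fin n → Fin n → Set
    FormIII x y = ∃[ i ] ∃[ j ] SamePair x y (v1 (i ↑ˡ β)) (w j)

    field
      e-edge  : ∀ i → Adj G (v1 i) (v2 i)
      e'-edge : ∀ i → Adj G (v1 (i ↑ˡ β)) (z i)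
      edges   : ∀ x y → Adj G x y →
                IsE x y ⊎ IsE' x y ⊎ FormI x y ⊎ FormII x y ⊎ FormIII x y

-- If I is an induced and M a maximal matching, every edge of I meets an edge of M, and no
-- edge of M meets two edges of I (it would bridge them); so |I| ≤ |M|, and ind-match = min-match
-- iff some induced I and maximal M have the same size.
--
-- For such I and M the map "I-edge ↦ an M-edge meeting it" is a bijection.  The M-edge met by
-- {v₁, v₂} ∈ I shares v₁ with it and is either {v₁, v₂} itself or a pendant edge {v₁, z}; the
-- pendant cases give the indices i ≤ α.  The leftover vertices w_j and the v₂ of the pendant
-- cases are not covered by M, so maximality forbids edges among them, and inducedness forbids
-- edges between different I-edges; the edges that remain are exactly those of forms (i)-(iii).
-- Conversely, in a graph of this shape the e_i form an induced matching, and the e'_i (i ≤ α)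
-- together with the e_i (i > α) form a maximal matching, both of size α + β.

module Submission where

open import Level using (0ℓ)
open import Defs renaming (sym to Adj-sym; irrefl to Adj-irrefl) hiding (dec)
open import Data.Nat using (ℕ; zero; suc; _+_; _≤_; s≤s)
open import Data.Nat.Properties using (≤-trans; ≤-reflexive; 1+n≰n)
open import Data.Fin using (Fin; zero; suc; _↑ˡ_; _↑ʳ_; splitAt; punchOut; _≟_)
import Data.Fin as Fin
open import Data.Fin.Properties
  using (any?; injective⇒≤; punchOut-injective; <-cmp; +↔⊎; ↑ˡ-injective;
         splitAt-↑ˡ; splitAt-↑ʳ; splitAt⁻¹-↑ˡ; splitAt⁻¹-↑ʳ)
open import Data.Maybe using (Maybe; just; nothing)
open import Data.Maybe.Properties using (just-injective)
open import Data.Product using (_×_; _,_; proj₁; proj₂; ∃; ∃-syntax)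
open import Data.Sum using (_⊎_; inj₁; inj₂; [_,_]′)
open import Data.Sum.Properties using (inj₂-injective)
open import Data.Sum.Algebra using (⊎-cong; ⊎-comm; ⊎-assoc)
open import Data.List using (List; _∷_; length; lookup; tabulate)
open import Data.List.Properties using (length-tabulate)
import Data.List.Relation.Unary.All as All
open import Data.List.Relation.Unary.All using (_∷_)
import Data.List.Relation.Unary.All.Properties as All
open import Data.List.Relation.Unary.Any as Any using (Any)
open import Data.List.Relation.Unary.Any.Properties using (lookup-index)
open import Data.List.Relation.Unary.AllPairs using (AllPairs; _∷_)
import Data.List.Relation.Unary.AllPairs.Properties as AllPairs
open import Data.List.Membership.Propositional.Properties using (∈-lookup)
open import Data.Empty using (⊥-elim)
open import Relation.Nullary using (¬_; Dec; yes; no; contradiction; ¬?)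
open import Relation.Nullary.Decidable using (_⊎-dec_)
open import Relation.Unary using (Decidable)
open import Relation.Binary.Core using (Rel)
open import Relation.Binary.Definitions using (Symmetric; tri<; tri≈; tri>)
open import Relation.Binary.PropositionalEquality
  using (_≡_; _≢_; refl; sym; trans; cong; subst; subst₂)
open import Function using (_∘_)
open import Function.Bundles using (_↔_; Inverse; Injection; mk↔ₛ′)
open import Function.Definitions using (Injective)
open import Function.Properties.Inverse using (Inverse⇒Injection)
open import Function.Construct.Identity using (↔-id)
open import Function.Construct.Symmetry using (↔-sym)
open import Function.Construct.Composition using (_↔-∘_)

module _ {A : Set} {R : Rel A 0ℓ} where

  AllPairs-lookup : ∀ {xs} → AllPairs R xs → ∀ {i j} → i Fin.< j → R (lookup xs i) (lookup xs j)
  AllPairs-lookup (Rx ∷ _)   {zero}  {suc j} _         = All.lookup Rx (∈-lookup j)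
  AllPairs-lookup (_ ∷ Rxs) {suc i} {suc j} (s≤s i<j) = AllPairs-lookup Rxs i<j

  AllPairs-lookup-≢ : Symmetric R → ∀ {xs} → AllPairs R xs → ∀ {i j} → i ≢ j →
                      R (lookup xs i) (lookup xs j)
  AllPairs-lookup-≢ R-sym Rxs {i} {j} i≢j with <-cmp i j
  ... | tri< i<j _ _ = AllPairs-lookup Rxs i<j
  ... | tri≈ _ i≡j _ = contradiction i≡j i≢j
  ... | tri> _ _ j<i = R-sym (AllPairs-lookup Rxs j<i)

injective∧≤⇒surjective : ∀ {m n} {f : Fin m → Fin n} → Injective _≡_ _≡_ f → n ≤ m →
                         ∀ y → ∃ λ x → f x ≡ y
injective∧≤⇒surjective {m} {suc n} {f} f-injective 1+n≤m y with any? (λ x → f x ≟ y)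
... | yes hit = hit
... | no miss = contradiction (≤-trans 1+n≤m (injective⇒≤ punched-injective)) 1+n≰n
  where
  y≢f : ∀ x → y ≢ f x
  y≢f x y≡fx = miss (x , sym y≡fx)
  punched-injective : Injective _≡_ _≡_ (λ x → punchOut (y≢f x))
  punched-injective {x} {x′} eq = f-injective (punchOut-injective (y≢f x) (y≢f x′) eq)

record FinSplit {n : ℕ} (P : Fin n → Set) : Set where
  field
    {inside outside} : ℕ
    enumeration : (Fin inside ⊎ Fin outside) ↔ Fin n
  open Inverse enumeration using (to; from; strictlyInverseˡ)
  field
    to-inside  : ∀ a → P (to (inj₁ a))
    to-outside : ∀ b → ¬ P (to (inj₂ b))

  inside-complete : ∀ {x} → P x → ∃ λ a → to (inj₁ a) ≡ x
  inside-complete {x} Px with from x | strictlyInverseˡ x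
  ... | inj₁ a | eq = a , eq
  ... | inj₂ b | eq = contradiction (subst P (sym eq) Px) (to-outside b)

  outside-complete : ∀ {x} → ¬ P x → ∃ λ b → to (inj₂ b) ≡ x
  outside-complete {x} ¬Px with from x | strictlyInverseˡ x
  ... | inj₁ a | eq = contradiction (subst P eq (to-inside a)) ¬Px
  ... | inj₂ b | eq = b , eq

⊎-sucˡ : ∀ {p q n} → (Fin p ⊎ Fin q) ↔ Fin n → (Fin (suc p) ⊎ Fin q) ↔ Fin (suc n)
-- Its forward map sends inj₁ zero to zero and commutes with suc definitionally; finSplit relies on this.
⊎-sucˡ e = ↔-sym +↔⊎ ↔-∘ (⊎-cong (↔-id _) e ↔-∘ (⊎-assoc 0ℓ _ _ _ ↔-∘ ⊎-cong +↔⊎ (↔-id _)))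

⊎-sucʳ : ∀ {p q n} → (Fin p ⊎ Fin q) ↔ Fin n → (Fin p ⊎ Fin (suc q)) ↔ Fin (suc n)
⊎-sucʳ e = ⊎-sucˡ (e ↔-∘ ⊎-comm _ _) ↔-∘ ⊎-comm _ _

finSplit : ∀ {n} {P : Fin n → Set} → Decidable P → FinSplit P
finSplit {zero} P? = record { enumeration = ↔-sym (+↔⊎ {0} {0}) ; to-inside = λ () ; to-outside = λ () }
finSplit {suc n} P? with P? zero | finSplit (P? ∘ suc)
... | yes P0 | S = record
  { enumeration = ⊎-sucˡ (FinSplit.enumeration S)
  ; to-inside   = λ { zero → P0 ; (suc a) → FinSplit.to-inside S a }
  ; to-outside  = FinSplit.to-outside S
  }
... | no ¬P0 | S = record
  { enumeration = ⊎-sucʳ (FinSplit.enumeration S)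
  ; to-inside   = FinSplit.to-inside S
  ; to-outside  = λ { zero → ¬P0 ; (suc b) → FinSplit.to-outside S b }
  }

∃-⊎? : ∀ {A B : Set} {P : A ⊎ B → Set} →
       Dec (∃ λ a → P (inj₁ a)) → Dec (∃ λ b → P (inj₂ b)) → Dec (∃ P)
∃-⊎? (yes (a , Pa)) _               = yes (inj₁ a , Pa)
∃-⊎? (no _)         (yes (b , Pb)) = yes (inj₂ b , Pb)
∃-⊎? (no ¬Pa)       (no ¬Pb)       =
  no λ { (inj₁ a , Pa) → ¬Pa (a , Pa) ; (inj₂ b , Pb) → ¬Pb (b , Pb) }

module ImageComplement {A : Set} {n : ℕ} (h : A → Fin n) (h-injective : Injective _≡_ _≡_ h)
                       (image? : Decidable (λ x → ∃ λ a → h a ≡ x)) where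

  private
    module S = FinSplit (finSplit image?)

  γ : ℕ
  γ = S.outside

  missed : Fin γ → Fin n
  missed b = Inverse.to S.enumeration (inj₂ b)

  missed-∉-image : ∀ b → ¬ (∃ λ a → h a ≡ missed b)
  missed-∉-image = S.to-outside

  embed : A ⊎ Fin γ → Fin n
  embed = [ h , missed ]′

  label : Fin n → A ⊎ Fin γ
  label x with image? x
  ... | yes (a , _) = inj₁ a
  ... | no x∉ = inj₂ (proj₁ (S.outside-complete x∉))

  embed-label : ∀ x → embed (label x) ≡ x
  embed-label x with image? x
  ... | yes (_ , ha≡x) = ha≡x
  ... | no x∉ = proj₂ (S.outside-complete x∉)

  label-embed : ∀ d → label (embed d) ≡ d
  label-embed (inj₁ a) with image? (h a)
  ... | yes (_ , ha′≡ha) = cong inj₁ (h-injective ha′≡ha)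
  ... | no ha∉ = contradiction (a , refl) ha∉
  label-embed (inj₂ b) with image? (missed b)
  ... | yes b∈ = contradiction b∈ (missed-∉-image b)
  ... | no b∉ = cong inj₂ (missed-injective (proj₂ (S.outside-complete b∉)))
    where
    missed-injective : Injective _≡_ _≡_ missed
    missed-injective = inj₂-injective ∘ Injection.injective (Inverse⇒Injection S.enumeration)

  bijection : (A ⊎ Fin γ) ↔ Fin n
  bijection = mk↔ₛ′ embed label embed-label label-embed

data Side (m n : ℕ) : Fin (m + n) → Set where
  left  : ∀ i → Side m n (i ↑ˡ n)
  right : ∀ j → Side m n (m ↑ʳ j)

side : ∀ m n i → Side m n i
side m n i with splitAt m i in eq
... | inj₁ a = subst (Side m n) (splitAt⁻¹-↑ˡ eq) (left a)
... | inj₂ b = subst (Side m n) (splitAt⁻¹-↑ʳ eq) (right b)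

_∈ᵉ_ : ∀ {n} → Fin n → Pair n → Set
x ∈ᵉ e = x ≡ proj₁ e ⊎ x ≡ proj₂ e

module _ {n : ℕ} (G : Graph n) where

  common⇒Meets : ∀ {x} e f → x ∈ᵉ e → x ∈ᵉ f → Meets G e f
  common⇒Meets _ _ (inj₁ refl) (inj₁ refl) = inj₁ refl
  common⇒Meets _ _ (inj₁ refl) (inj₂ refl) = inj₂ (inj₁ refl)
  common⇒Meets _ _ (inj₂ refl) (inj₁ refl) = inj₂ (inj₂ (inj₁ refl))
  common⇒Meets _ _ (inj₂ refl) (inj₂ refl) = inj₂ (inj₂ (inj₂ refl))

  Meets⇒common : ∀ e f → Meets G e f → ∃ λ x → x ∈ᵉ e × x ∈ᵉ f
  Meets⇒common _ _ (inj₁ a≡c)                 = _ , inj₁ refl , inj₁ a≡c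
  Meets⇒common _ _ (inj₂ (inj₁ a≡d))          = _ , inj₁ refl , inj₂ a≡d
  Meets⇒common _ _ (inj₂ (inj₂ (inj₁ b≡c)))  = _ , inj₂ refl , inj₁ b≡c
  Meets⇒common _ _ (inj₂ (inj₂ (inj₂ b≡d)))  = _ , inj₂ refl , inj₂ b≡d

  Disjoint⇒¬common : ∀ e f → Disjoint G e f → ∀ {x} → x ∈ᵉ e → ¬ x ∈ᵉ f
  Disjoint⇒¬common _ _ (a≢c , _ , _ , _) (inj₁ refl) (inj₁ x≡c) = a≢c x≡c
  Disjoint⇒¬common _ _ (_ , a≢d , _ , _) (inj₁ refl) (inj₂ x≡d) = a≢d x≡d
  Disjoint⇒¬common _ _ (_ , _ , b≢c , _) (inj₂ refl) (inj₁ x≡c) = b≢c x≡c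
  Disjoint⇒¬common _ _ (_ , _ , _ , b≢d) (inj₂ refl) (inj₂ x≡d) = b≢d x≡d

  ¬Meets⇒Disjoint : ∀ e f → ¬ Meets G e f → Disjoint G e f
  ¬Meets⇒Disjoint _ _ ¬meets =
    ¬meets ∘ inj₁ , ¬meets ∘ inj₂ ∘ inj₁ ,
    ¬meets ∘ inj₂ ∘ inj₂ ∘ inj₁ , ¬meets ∘ inj₂ ∘ inj₂ ∘ inj₂

  ¬common⇒Disjoint : ∀ e f → (∀ {x} → x ∈ᵉ e → ¬ x ∈ᵉ f) → Disjoint G e f
  ¬common⇒Disjoint e f ¬common = ¬Meets⇒Disjoint e f λ meets →
    let _ , x∈e , x∈f = Meets⇒common e f meets in ¬common x∈e x∈f

  Meets? : ∀ e f → Dec (Meets G e f)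
  Meets? (a , b) (c , d) = a ≟ c ⊎-dec a ≟ d ⊎-dec b ≟ c ⊎-dec b ≟ d

  Disjoint-sym : ∀ {e f} → Disjoint G e f → Disjoint G f e
  Disjoint-sym (a≢c , a≢d , b≢c , b≢d) = a≢c ∘ sym , b≢c ∘ sym , a≢d ∘ sym , b≢d ∘ sym

  ThreeDisjoint-sym : ∀ {e f} → ThreeDisjoint G e f → ThreeDisjoint G f e
  ThreeDisjoint-sym (disjoint , ¬bridge) =
    Disjoint-sym disjoint , λ g g-edge (f∩g , e∩g) → ¬bridge g g-edge (e∩g , f∩g)

  SamePair-∈ : ∀ {x y a b v} → SamePair G x y a b → v ∈ᵉ (a , b) → v ∈ᵉ (x , y)
  SamePair-∈ (inj₁ (refl , refl)) v∈ab = v∈ab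
  SamePair-∈ (inj₂ (refl , refl)) (inj₁ v≡a) = inj₂ v≡a
  SamePair-∈ (inj₂ (refl , refl)) (inj₂ v≡b) = inj₁ v≡b

  SamePair-∈⁻ : ∀ {x y a b v} → SamePair G x y a b → v ∈ᵉ (x , y) → v ∈ᵉ (a , b)
  SamePair-∈⁻ (inj₁ (refl , refl)) v∈xy = v∈xy
  SamePair-∈⁻ (inj₂ (refl , refl)) (inj₁ v≡x) = inj₂ v≡x
  SamePair-∈⁻ (inj₂ (refl , refl)) (inj₂ v≡y) = inj₁ v≡y

  SamePair-Adj : ∀ {x y a b} → SamePair G x y a b → Adj G x y → Adj G a b
  SamePair-Adj (inj₁ (refl , refl)) adj = adj
  SamePair-Adj (inj₂ (refl , refl)) adj = Adj-sym G adj

  SamePair-swap : ∀ {x y a b} → SamePair G x y a b → SamePair G y x a b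
  SamePair-swap (inj₁ (x≡a , y≡b)) = inj₂ (y≡b , x≡a)
  SamePair-swap (inj₂ (x≡b , y≡a)) = inj₁ (y≡a , x≡b)

  record Overlap (e f : Pair n) : Set where
    field
      shared e-other f-other : Fin n
      e≈ : SamePair G (proj₁ e) (proj₂ e) shared e-other
      f≈ : SamePair G (proj₁ f) (proj₂ f) shared f-other

  Meets⇒Overlap : ∀ e f → Meets G e f → Overlap e f
  Meets⇒Overlap (a , b) (c , d) (inj₁ refl) =
    record { shared = a ; e-other = b ; f-other = d ; e≈ = inj₁ (refl , refl) ; f≈ = inj₁ (refl , refl) }
  Meets⇒Overlap (a , b) (c , d) (inj₂ (inj₁ refl)) =
    record { shared = a ; e-other = b ; f-other = c ; e≈ = inj₁ (refl , refl) ; f≈ = inj₂ (refl , refl) }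
  Meets⇒Overlap (a , b) (c , d) (inj₂ (inj₂ (inj₁ refl))) =
    record { shared = b ; e-other = a ; f-other = d ; e≈ = inj₂ (refl , refl) ; f≈ = inj₁ (refl , refl) }
  Meets⇒Overlap (a , b) (c , d) (inj₂ (inj₂ (inj₂ refl))) =
    record { shared = b ; e-other = a ; f-other = c ; e≈ = inj₂ (refl , refl) ; f≈ = inj₂ (refl , refl) }

  matching-edge : ∀ {M} → IsMatching G M → ∀ i → IsEdge G (lookup M i)
  matching-edge (edges , _) i = All.lookup edges (∈-lookup i)

  matching-disjoint : ∀ {M} → IsMatching G M → ∀ {i j} → i ≢ j → Disjoint G (lookup M i) (lookup M j)
  matching-disjoint (_ , disjoint) = AllPairs-lookup-≢ Disjoint-sym disjoint

  induced-edge : ∀ {I} → IsInducedMatching G I → ∀ i → IsEdge G (lookup I i)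
  induced-edge (edges , _) i = All.lookup edges (∈-lookup i)

  induced-threeDisjoint : ∀ {I} → IsInducedMatching G I → ∀ {i j} → i ≢ j →
                          ThreeDisjoint G (lookup I i) (lookup I j)
  induced-threeDisjoint (_ , threeDisjoint) = AllPairs-lookup-≢ ThreeDisjoint-sym threeDisjoint

  maximal⇒meets : ∀ {M} → IsMaximalMatching G M → ∀ {e} → IsEdge G e → Any (Meets G e) M
  maximal⇒meets {M} ((edges , disjoint) , maximal) {e} e-edge with Any.any? (Meets? e) M
  ... | yes meets = meets
  ... | no ¬meets = contradiction
    ((e-edge ∷ edges) , All.map (¬Meets⇒Disjoint e _) (All.¬Any⇒All¬ M ¬meets) ∷ disjoint)
    (maximal e e-edge)

  Uncovered : List (Pair n) → Fin n → Set
  Uncovered M x = ∀ i → ¬ x ∈ᵉ lookup M i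

  maximal⇒uncovered-independent : ∀ {M x y} → IsMaximalMatching G M →
                                   Uncovered M x → Uncovered M y → ¬ Adj G x y
  maximal⇒uncovered-independent {M} {x} {y} M-maximal x-uncovered y-uncovered adj
    with Meets⇒common (x , y) _ (lookup-index (maximal⇒meets M-maximal {x , y} adj))
  ... | _ , inj₁ refl , v∈g = x-uncovered _ v∈g
  ... | _ , inj₂ refl , v∈g = y-uncovered _ v∈g

  module InducedIntoMaximal {I M : List (Pair n)}
           (I-induced : IsInducedMatching G I) (M-maximal : IsMaximalMatching G M) where

    φ : Fin (length I) → Fin (length M)
    φ p = Any.index (maximal⇒meets M-maximal (induced-edge I-induced p))

    φ-meets : ∀ p → Meets G (lookup I p) (lookup M (φ p))
    φ-meets p = lookup-index (maximal⇒meets M-maximal (induced-edge I-induced p))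

    φ-injective : Injective _≡_ _≡_ φ
    φ-injective {p} {q} φp≡φq with p ≟ q
    ... | yes p≡q = p≡q
    ... | no p≢q = contradiction
      (φ-meets p , subst (Meets G (lookup I q) ∘ lookup M) (sym φp≡φq) (φ-meets q))
      (proj₂ (induced-threeDisjoint I-induced p≢q) _ (matching-edge (proj₁ M-maximal) (φ p)))

  induced≤maximal : ∀ {I M} → IsInducedMatching G I → IsMaximalMatching G M → length I ≤ length M
  induced≤maximal I-induced M-maximal = injective⇒≤ φ-injective
    where open InducedIntoMaximal I-induced M-maximal

  equal-size⇒ind≡min : ∀ {I M} → IsInducedMatching G I → IsMaximalMatching G M →
                       length I ≡ length M → IndMatchIs G (length I) × MinMatchIs G (length I)
  equal-size⇒ind≡min {I} {M} I-induced M-maximal |I|≡|M| =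
    ((I , I-induced , refl) ,
     λ I′ I′-induced → subst (length I′ ≤_) (sym |I|≡|M|) (induced≤maximal I′-induced M-maximal)) ,
    ((M , M-maximal , sym |I|≡|M|) ,
     λ M′ M′-maximal → induced≤maximal I-induced M′-maximal)

module MatchingsFromStructure {n : ℕ} {G : Graph n} {α β γ : ℕ} (S : Structure G α β γ) where
  open Structure S
  open Inverse partition using (from; strictlyInverseʳ)

  Label : Set
  Label = (Fin (α + β) ⊎ Fin (α + β)) ⊎ (Fin α ⊎ Fin γ)

  e : Fin (α + β) → Pair n
  e i = v1 i , v2 i

  endLabel : Label → Maybe (Fin (α + β))
  endLabel (inj₁ (inj₁ i)) = just i
  endLabel (inj₁ (inj₂ i)) = just i
  endLabel (inj₂ _)        = nothing

  end : Fin n → Maybe (Fin (α + β))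
  end = endLabel ∘ from

  end-v1 : ∀ i → end (v1 i) ≡ just i
  end-v1 i = cong endLabel (strictlyInverseʳ _)

  end-v2 : ∀ i → end (v2 i) ≡ just i
  end-v2 i = cong endLabel (strictlyInverseʳ _)

  end-z : ∀ a → end (z a) ≡ nothing
  end-z a = cong endLabel (strictlyInverseʳ _)

  end-w : ∀ j → end (w j) ≡ nothing
  end-w j = cong endLabel (strictlyInverseʳ _)

  ∈e⇒end : ∀ {x i} → x ∈ᵉ e i → end x ≡ just i
  ∈e⇒end (inj₁ refl) = end-v1 _
  ∈e⇒end (inj₂ refl) = end-v2 _

  SamePair-end : ∀ {x y a b} → SamePair G x y a b → end a ≡ end b → end x ≡ end y
  SamePair-end (inj₁ (refl , refl)) ends = ends
  SamePair-end (inj₂ (refl , refl)) ends = sym ends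

  SamePair-end-nothing : ∀ {x y a b} → SamePair G x y a b → end b ≡ nothing →
                         end x ≡ nothing ⊎ end y ≡ nothing
  SamePair-end-nothing (inj₁ (refl , refl)) b-off = inj₂ b-off
  SamePair-end-nothing (inj₂ (refl , refl)) b-off = inj₁ b-off

  edge-end : ∀ {x y} → Adj G x y → end x ≡ end y ⊎ end x ≡ nothing ⊎ end y ≡ nothing
  edge-end {x} {y} adj with edges x y adj
  ... | inj₁ (i , xy≈e)                                = inj₁ (SamePair-end xy≈e (trans (end-v1 i) (sym (end-v2 i))))
  ... | inj₂ (inj₁ (a , xy≈e′))                        = inj₂ (SamePair-end-nothing xy≈e′ (end-z a))
  ... | inj₂ (inj₂ (inj₁ (a , inj₁ refl)))             = inj₂ (inj₁ (end-z a))
  ... | inj₂ (inj₂ (inj₁ (a , inj₂ refl)))             = inj₂ (inj₂ (end-z a))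
  ... | inj₂ (inj₂ (inj₂ (inj₁ (_ , j , inj₁ xy≈)))) = inj₂ (SamePair-end-nothing xy≈ (end-w j))
  ... | inj₂ (inj₂ (inj₂ (inj₁ (_ , j , inj₂ xy≈)))) = inj₂ (SamePair-end-nothing xy≈ (end-w j))
  ... | inj₂ (inj₂ (inj₂ (inj₂ (_ , j , xy≈))))       = inj₂ (SamePair-end-nothing xy≈ (end-w j))

  adjacent-ends : ∀ {x y i j} → Adj G x y → end x ≡ just i → end y ≡ just j → i ≡ j
  adjacent-ends adj x-end y-end with edge-end adj
  ... | inj₁ x≡y        = just-injective (trans (sym x-end) (trans x≡y y-end))
  ... | inj₂ (inj₁ x-off) = contradiction (trans (sym x-off) x-end) λ ()
  ... | inj₂ (inj₂ y-off) = contradiction (trans (sym y-off) y-end) λ ()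

  ends-of-edge : ∀ {f u v i j} → IsEdge G f → u ∈ᵉ f → v ∈ᵉ f →
                 end u ≡ just i → end v ≡ just j → i ≡ j
  ends-of-edge _   (inj₁ refl) (inj₁ refl) u-end v-end = just-injective (trans (sym u-end) v-end)
  ends-of-edge adj (inj₁ refl) (inj₂ refl) u-end v-end = adjacent-ends adj u-end v-end
  ends-of-edge adj (inj₂ refl) (inj₁ refl) u-end v-end = adjacent-ends (Adj-sym G adj) u-end v-end
  ends-of-edge _   (inj₂ refl) (inj₂ refl) u-end v-end = just-injective (trans (sym u-end) v-end)

  e-threeDisjoint : ∀ {i j} → i ≢ j → ThreeDisjoint G (e i) (e j)
  e-threeDisjoint {i} {j} i≢j =
    ¬common⇒Disjoint G (e i) (e j) (λ x∈ei x∈ej →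
      i≢j (just-injective (trans (sym (∈e⇒end x∈ei)) (∈e⇒end x∈ej)))) ,
    λ f f-edge (ei∩f , ej∩f) →
      let u , u∈ei , u∈f = Meets⇒common G (e i) f ei∩f
          v , v∈ej , v∈f = Meets⇒common G (e j) f ej∩f
      in i≢j (ends-of-edge f-edge u∈f v∈f (∈e⇒end u∈ei) (∈e⇒end v∈ej))

  e-induced : IsInducedMatching G (tabulate e)
  e-induced = All.tabulate⁺ e-edge , AllPairs.tabulate⁺ e-threeDisjoint

  partner : Fin (α + β) → Fin n
  partner i = [ z , v2 ∘ (α ↑ʳ_) ]′ (splitAt α i)

  partner-↑ˡ : ∀ a → partner (a ↑ˡ β) ≡ z a
  partner-↑ˡ a = cong [ z , v2 ∘ (α ↑ʳ_) ]′ (splitAt-↑ˡ α a β)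

  partner-↑ʳ : ∀ b → partner (α ↑ʳ b) ≡ v2 (α ↑ʳ b)
  partner-↑ʳ b = cong [ z , v2 ∘ (α ↑ʳ_) ]′ (splitAt-↑ʳ α β b)

  m : Fin (α + β) → Pair n
  m i = v1 i , partner i

  m-edge : ∀ i → IsEdge G (m i)
  m-edge i with side α β i
  ... | left a  = subst (Adj G (v1 (a ↑ˡ β))) (sym (partner-↑ˡ a)) (e'-edge a)
  ... | right b = subst (Adj G (v1 (α ↑ʳ b))) (sym (partner-↑ʳ b)) (e-edge (α ↑ʳ b))

  -- Only x ∈ m i ⇒ owner x ≡ just i holds: v2 (a ↑ˡ β) has an owner but lies on no m-edge.
  ownerLabel : Label → Maybe (Fin (α + β))
  ownerLabel (inj₁ (inj₁ i)) = just i
  ownerLabel (inj₁ (inj₂ i)) = just i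
  ownerLabel (inj₂ (inj₁ a)) = just (a ↑ˡ β)
  ownerLabel (inj₂ (inj₂ _)) = nothing

  owner : Fin n → Maybe (Fin (α + β))
  owner = ownerLabel ∘ from

  ∈m⇒owner : ∀ {x i} → x ∈ᵉ m i → owner x ≡ just i
  ∈m⇒owner (inj₁ refl) = cong ownerLabel (strictlyInverseʳ _)
  ∈m⇒owner {i = i} (inj₂ refl) with side α β i
  ... | left a  rewrite partner-↑ˡ a = cong ownerLabel (strictlyInverseʳ _)
  ... | right b rewrite partner-↑ʳ b = cong ownerLabel (strictlyInverseʳ _)

  m-disjoint : ∀ {i j} → i ≢ j → Disjoint G (m i) (m j)
  m-disjoint {i} {j} i≢j = ¬common⇒Disjoint G (m i) (m j) λ x∈mi x∈mj →
    i≢j (just-injective (trans (sym (∈m⇒owner x∈mi)) (∈m⇒owner x∈mj)))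

  Covered : Fin n → Set
  Covered x = ∃ λ i → x ∈ᵉ m i

  SamePair-covered : ∀ {x y a b} → SamePair G x y a b → Covered a → Covered x ⊎ Covered y
  SamePair-covered (inj₁ (refl , refl)) a-covered = inj₁ a-covered
  SamePair-covered (inj₂ (refl , refl)) a-covered = inj₂ a-covered

  edge-covered : ∀ {x y} → Adj G x y → Covered x ⊎ Covered y
  edge-covered {x} {y} adj with edges x y adj
  ... | inj₁ (i , xy≈e)                                = SamePair-covered xy≈e (i , inj₁ refl)
  ... | inj₂ (inj₁ (a , xy≈e′))                        = SamePair-covered xy≈e′ (a ↑ˡ β , inj₁ refl)
  ... | inj₂ (inj₂ (inj₁ (a , inj₁ refl)))             = inj₁ (a ↑ˡ β , inj₂ (sym (partner-↑ˡ a)))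
  ... | inj₂ (inj₂ (inj₁ (a , inj₂ refl)))             = inj₂ (a ↑ˡ β , inj₂ (sym (partner-↑ˡ a)))
  ... | inj₂ (inj₂ (inj₂ (inj₁ (b , _ , inj₁ xy≈)))) = SamePair-covered xy≈ (α ↑ʳ b , inj₁ refl)
  ... | inj₂ (inj₂ (inj₂ (inj₁ (b , _ , inj₂ xy≈)))) = SamePair-covered xy≈ (α ↑ʳ b , inj₂ (sym (partner-↑ʳ b)))
  ... | inj₂ (inj₂ (inj₂ (inj₂ (a , _ , xy≈))))       = SamePair-covered xy≈ (a ↑ˡ β , inj₁ refl)

  m-maximal : IsMaximalMatching G (tabulate m)
  m-maximal = (All.tabulate⁺ m-edge , AllPairs.tabulate⁺ m-disjoint) , maximal
    where
    maximal : ∀ f → IsEdge G f → ¬ IsMatching G (f ∷ tabulate m)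
    maximal (x , y) adj (_ , f-disjoint ∷ _) with edge-covered adj
    ... | inj₁ (i , x∈mi) = Disjoint⇒¬common G (x , y) (m i) (All.tabulate⁻ f-disjoint i) (inj₁ refl) x∈mi
    ... | inj₂ (i , y∈mi) = Disjoint⇒¬common G (x , y) (m i) (All.tabulate⁻ f-disjoint i) (inj₂ refl) y∈mi

  ind≡min : ∃ λ k → IndMatchIs G k × MinMatchIs G k
  ind≡min = _ , equal-size⇒ind≡min G e-induced m-maximal (trans (length-tabulate e) (sym (length-tabulate m)))

module StructureFromMatchings {n : ℕ} (G : Graph n) {I M : List (Pair n)}
         (I-induced : IsInducedMatching G I) (M-maximal : IsMaximalMatching G M)
         (|M|≤|I| : length M ≤ length I) where
  open InducedIntoMaximal G I-induced M-maximal

  K : ℕ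
  K = length I

  φ-surjective : ∀ g → ∃ λ p → φ p ≡ g
  φ-surjective = injective∧≤⇒surjective φ-injective |M|≤|I|

  -- Opaque only to keep type checking fast: unfolding these runs Meets⇒Overlap on φ-meets.
  opaque
    meeting : ∀ p → Overlap G (lookup I p) (lookup M (φ p))
    meeting p = Meets⇒Overlap G _ _ (φ-meets p)

    v₁ v₂ z : Fin K → Fin n
    v₁ p = Overlap.shared (meeting p)
    v₂ p = Overlap.e-other (meeting p)
    z p = Overlap.f-other (meeting p)

    E⊆I : ∀ {x p} → x ∈ᵉ (v₁ p , v₂ p) → x ∈ᵉ lookup I p
    E⊆I {p = p} = SamePair-∈ G (Overlap.e≈ (meeting p))

    F⊆M : ∀ {x p} → x ∈ᵉ (v₁ p , z p) → x ∈ᵉ lookup M (φ p)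
    F⊆M {p = p} = SamePair-∈ G (Overlap.f≈ (meeting p))

    M⊆F : ∀ {x p} → x ∈ᵉ lookup M (φ p) → x ∈ᵉ (v₁ p , z p)
    M⊆F {p = p} = SamePair-∈⁻ G (Overlap.f≈ (meeting p))

    E-edge : ∀ p → Adj G (v₁ p) (v₂ p)
    E-edge p = SamePair-Adj G (Overlap.e≈ (meeting p)) (induced-edge G I-induced p)

    F-edge : ∀ p → Adj G (v₁ p) (z p)
    F-edge p = SamePair-Adj G (Overlap.f≈ (meeting p)) (matching-edge G (proj₁ M-maximal) (φ p))

  E F : Fin K → Pair n
  E p = v₁ p , v₂ p
  F p = v₁ p , z p

  ∈E-injective : ∀ {x p q} → x ∈ᵉ E p → x ∈ᵉ E q → p ≡ q
  ∈E-injective {p = p} {q} x∈Ep x∈Eq with p ≟ q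
  ... | yes p≡q = p≡q
  ... | no p≢q = ⊥-elim (Disjoint⇒¬common G _ _ (proj₁ (induced-threeDisjoint G I-induced p≢q))
                                            (E⊆I x∈Ep) (E⊆I x∈Eq))

  E-bridge-free : ∀ {x y p q} → Adj G x y → x ∈ᵉ E p → y ∈ᵉ E q → p ≡ q
  E-bridge-free {x} {y} {p} {q} adj x∈Ep y∈Eq with p ≟ q
  ... | yes p≡q = p≡q
  ... | no p≢q = contradiction
    (common⇒Meets G _ (x , y) (E⊆I x∈Ep) (inj₁ refl) , common⇒Meets G _ (x , y) (E⊆I y∈Eq) (inj₂ refl))
    (proj₂ (induced-threeDisjoint G I-induced p≢q) (x , y) adj)

  v₁-independent : ∀ {p q} → ¬ Adj G (v₁ p) (v₁ q)
  v₁-independent adj with refl ← E-bridge-free adj (inj₁ refl) (inj₁ refl) = Adj-irrefl G adj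

  v₂-independent : ∀ {p q} → ¬ Adj G (v₂ p) (v₂ q)
  v₂-independent adj with refl ← E-bridge-free adj (inj₂ refl) (inj₂ refl) = Adj-irrefl G adj

  v₁≢v₂ : ∀ {p q} → v₁ p ≢ v₂ q
  v₁≢v₂ {p} v₁≡v₂ with ∈E-injective {p = p} (inj₁ refl) (inj₂ v₁≡v₂)
  ... | refl = Adj-irrefl G (subst (Adj G (v₁ p)) (sym v₁≡v₂) (E-edge p))

  z-injective : ∀ {p q} → z p ≡ z q → p ≡ q
  z-injective {p} {q} zp≡zq with φ p ≟ φ q
  ... | yes φp≡φq = φ-injective φp≡φq
  ... | no φp≢φq = ⊥-elim (Disjoint⇒¬common G _ _ (matching-disjoint G (proj₁ M-maximal) φp≢φq)
                                              (F⊆M {p = p} (inj₂ refl)) (F⊆M {p = q} (inj₂ zp≡zq)))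

  -- The M-edge meeting the p-th I-edge is then a pendant edge {v₁ p, z p}; these p become
  -- the indices i ≤ α.
  Forked : Fin K → Set
  Forked p = z p ≢ v₂ p

  forked-z∉E : ∀ {p q} → Forked p → ¬ z p ∈ᵉ E q
  forked-z∉E {p} {q} forked z∈Eq with q ≟ p
  ... | yes refl = [ (λ z≡v₁ → Adj-irrefl G (subst (Adj G (v₁ p)) z≡v₁ (F-edge p))) , forked ]′ z∈Eq
  ... | no q≢p = proj₂ (induced-threeDisjoint G I-induced q≢p) _ (matching-edge G (proj₁ M-maximal) (φ p))
                   (common⇒Meets G _ _ (E⊆I z∈Eq) (F⊆M {p = p} (inj₂ refl)) , φ-meets p)

  covered⇒∈F : ∀ {x} g → x ∈ᵉ lookup M g → ∃ λ p → x ∈ᵉ F p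
  covered⇒∈F g x∈g with φ-surjective g
  ... | p , refl = p , M⊆F x∈g

  private
    module Classes = FinSplit (finSplit (λ p → ¬? (z p ≟ v₂ p)))

  α β : ℕ
  α = Classes.inside
  β = Classes.outside

  reindex : Fin (α + β) ↔ Fin K
  reindex = Classes.enumeration ↔-∘ +↔⊎

  ι : Fin (α + β) → Fin K
  ι = Inverse.to reindex

  ι-injective : Injective _≡_ _≡_ ι
  ι-injective = Injection.injective (Inverse⇒Injection reindex)

  σ : Fin α → Fin K
  σ a = ι (a ↑ˡ β)

  σ-forked : ∀ a → Forked (σ a)
  σ-forked a = subst (Forked ∘ Inverse.to Classes.enumeration) (sym (splitAt-↑ˡ α a β)) (Classes.to-inside a)

  forked⇒σ : ∀ {p} → Forked p → ∃ λ a → σ a ≡ p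
  forked⇒σ forked with a , a↦p ← Classes.inside-complete forked =
    a , trans (cong (Inverse.to Classes.enumeration) (splitAt-↑ˡ α a β)) a↦p

  Vertex : Set
  Vertex = (Fin (α + β) ⊎ Fin (α + β)) ⊎ Fin α

  vertex : Vertex → Fin n
  vertex (inj₁ (inj₁ i)) = v₁ (ι i)
  vertex (inj₁ (inj₂ i)) = v₂ (ι i)
  vertex (inj₂ a)        = z (σ a)

  vertex-injective : Injective _≡_ _≡_ vertex
  vertex-injective {inj₁ (inj₁ i)} {inj₁ (inj₁ j)} eq =
    cong (inj₁ ∘ inj₁) (ι-injective (∈E-injective (inj₁ refl) (inj₁ eq)))
  vertex-injective {inj₁ (inj₂ i)} {inj₁ (inj₂ j)} eq =
    cong (inj₁ ∘ inj₂) (ι-injective (∈E-injective (inj₂ refl) (inj₂ eq)))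
  vertex-injective {inj₁ (inj₁ i)} {inj₁ (inj₂ j)} eq = contradiction eq v₁≢v₂
  vertex-injective {inj₁ (inj₂ i)} {inj₁ (inj₁ j)} eq = contradiction (sym eq) v₁≢v₂
  vertex-injective {inj₁ (inj₁ i)} {inj₂ a}        eq = contradiction (inj₁ (sym eq)) (forked-z∉E (σ-forked a))
  vertex-injective {inj₁ (inj₂ i)} {inj₂ a}        eq = contradiction (inj₂ (sym eq)) (forked-z∉E (σ-forked a))
  vertex-injective {inj₂ a}        {inj₁ (inj₁ i)} eq = contradiction (inj₁ eq) (forked-z∉E (σ-forked a))
  vertex-injective {inj₂ a}        {inj₁ (inj₂ i)} eq = contradiction (inj₂ eq) (forked-z∉E (σ-forked a))
  vertex-injective {inj₂ a}        {inj₂ b}        eq =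
    cong inj₂ (↑ˡ-injective β a b (ι-injective (z-injective eq)))

  Image : Fin n → Set
  Image x = ∃ λ d → vertex d ≡ x

  image? : Decidable Image
  image? x = ∃-⊎? (∃-⊎? (any? λ i → v₁ (ι i) ≟ x) (any? λ i → v₂ (ι i) ≟ x))
                   (any? λ a → z (σ a) ≟ x)

  ∈F⇒image : ∀ {x p} → x ∈ᵉ F p → Image x
  ∈F⇒image {p = p} (inj₁ refl) =
    inj₁ (inj₁ (Inverse.from reindex p)) , cong v₁ (Inverse.strictlyInverseˡ reindex p)
  ∈F⇒image {p = p} (inj₂ refl) with z p ≟ v₂ p
  ... | yes z≡v₂ =
    inj₁ (inj₂ (Inverse.from reindex p)) , trans (cong v₂ (Inverse.strictlyInverseˡ reindex p)) (sym z≡v₂)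
  ... | no forked with a , σa≡p ← forked⇒σ forked = inj₂ a , cong z σa≡p

  open ImageComplement vertex vertex-injective image? using (γ; missed; missed-∉-image; bijection)

  Label : Set
  Label = (Fin (α + β) ⊎ Fin (α + β)) ⊎ (Fin α ⊎ Fin γ)

  partition : Label ↔ Fin n
  partition = bijection ↔-∘ ↔-sym (⊎-assoc 0ℓ _ _ _)

  missed-uncovered : ∀ j → Uncovered G M (missed j)
  missed-uncovered j g x∈g with p , x∈Fp ← covered⇒∈F g x∈g = missed-∉-image j (∈F⇒image x∈Fp)

  forked-v₂-uncovered : ∀ {p} → Forked p → Uncovered G M (v₂ p)
  forked-v₂-uncovered {p} forked g v₂∈g with covered⇒∈F g v₂∈g
  ... | q , inj₁ v₂≡v₁ = v₁≢v₂ (sym v₂≡v₁)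
  ... | q , inj₂ v₂≡z with z q ≟ v₂ q
  ...   | no forked-q = forked-z∉E forked-q (inj₂ (sym v₂≡z))
  ...   | yes z≡v₂ with ∈E-injective {p = p} (inj₂ refl) (inj₂ (trans v₂≡z z≡v₂))
  ...     | refl = forked z≡v₂

  V₁ V₂ : Fin (α + β) → Fin n
  V₁ = v₁ ∘ ι
  V₂ = v₂ ∘ ι

  Classified : Fin n → Fin n → Set
  Classified x y =
      (∃[ i ] SamePair G x y (V₁ i) (V₂ i))
    ⊎ (∃[ a ] SamePair G x y (V₁ (a ↑ˡ β)) (z (σ a)))
    ⊎ (∃[ a ] (x ≡ z (σ a) ⊎ y ≡ z (σ a)))
    ⊎ (∃[ b ] ∃[ j ] (SamePair G x y (V₁ (α ↑ʳ b)) (missed j) ⊎ SamePair G x y (V₂ (α ↑ʳ b)) (missed j)))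
    ⊎ (∃[ a ] ∃[ j ] SamePair G x y (V₁ (a ↑ˡ β)) (missed j))

  Classified-swap : ∀ {x y} → Classified x y → Classified y x
  Classified-swap (inj₁ (i , xy≈)) = inj₁ (i , SamePair-swap G xy≈)
  Classified-swap (inj₂ (inj₁ (a , xy≈))) = inj₂ (inj₁ (a , SamePair-swap G xy≈))
  Classified-swap (inj₂ (inj₂ (inj₁ (a , x≡z⊎y≡z)))) =
    inj₂ (inj₂ (inj₁ (a , [ inj₂ , inj₁ ]′ x≡z⊎y≡z)))
  Classified-swap (inj₂ (inj₂ (inj₂ (inj₁ (b , j , xy≈))))) =
    inj₂ (inj₂ (inj₂ (inj₁ (b , j , [ inj₁ ∘ SamePair-swap G , inj₂ ∘ SamePair-swap G ]′ xy≈))))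
  Classified-swap (inj₂ (inj₂ (inj₂ (inj₂ (a , j , xy≈))))) =
    inj₂ (inj₂ (inj₂ (inj₂ (a , j , SamePair-swap G xy≈))))

  V₁V₂-edge : ∀ i j → Adj G (V₁ i) (V₂ j) → Classified (V₁ i) (V₂ j)
  V₁V₂-edge i j adj with ι-injective (E-bridge-free adj (inj₁ refl) (inj₂ refl))
  ... | refl = inj₁ (i , inj₁ (refl , refl))

  V₁-missed-edge : ∀ i j → Classified (V₁ i) (missed j)
  V₁-missed-edge i j with side α β i
  ... | left a  = inj₂ (inj₂ (inj₂ (inj₂ (a , j , inj₁ (refl , refl)))))
  ... | right b = inj₂ (inj₂ (inj₂ (inj₁ (b , j , inj₁ (inj₁ (refl , refl))))))

  V₂-missed-edge : ∀ i j → Adj G (V₂ i) (missed j) → Classified (V₂ i) (missed j)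
  V₂-missed-edge i j adj with side α β i
  ... | left a  = ⊥-elim (maximal⇒uncovered-independent G M-maximal
                            (forked-v₂-uncovered (σ-forked a)) (missed-uncovered j) adj)
  ... | right b = inj₂ (inj₂ (inj₂ (inj₁ (b , j , inj₂ (inj₁ (refl , refl))))))

  open Inverse partition using (to; from; strictlyInverseˡ)

  classify : ∀ s t → Adj G (to s) (to t) → Classified (to s) (to t)
  classify (inj₂ (inj₁ a)) _ _ = inj₂ (inj₂ (inj₁ (a , inj₁ refl)))
  classify _ (inj₂ (inj₁ a)) _ = inj₂ (inj₂ (inj₁ (a , inj₂ refl)))
  classify (inj₁ (inj₁ i)) (inj₁ (inj₁ j)) adj = ⊥-elim (v₁-independent adj)
  classify (inj₁ (inj₂ i)) (inj₁ (inj₂ j)) adj = ⊥-elim (v₂-independent adj)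
  classify (inj₁ (inj₁ i)) (inj₁ (inj₂ j)) adj = V₁V₂-edge i j adj
  classify (inj₁ (inj₂ i)) (inj₁ (inj₁ j)) adj = Classified-swap (V₁V₂-edge j i (Adj-sym G adj))
  classify (inj₁ (inj₁ i)) (inj₂ (inj₂ j)) _   = V₁-missed-edge i j
  classify (inj₂ (inj₂ j)) (inj₁ (inj₁ i)) _   = Classified-swap (V₁-missed-edge i j)
  classify (inj₁ (inj₂ i)) (inj₂ (inj₂ j)) adj = V₂-missed-edge i j adj
  classify (inj₂ (inj₂ j)) (inj₁ (inj₂ i)) adj = Classified-swap (V₂-missed-edge i j (Adj-sym G adj))
  classify (inj₂ (inj₂ j)) (inj₂ (inj₂ j′)) adj =
    ⊥-elim (maximal⇒uncovered-independent G M-maximal (missed-uncovered j) (missed-uncovered j′) adj)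

  edges : ∀ x y → Adj G x y → Classified x y
  edges x y adj = subst₂ Classified (strictlyInverseˡ x) (strictlyInverseˡ y)
    (classify (from x) (from y) (subst₂ (Adj G) (sym (strictlyInverseˡ x)) (sym (strictlyInverseˡ y)) adj))

  structure : Structure G α β γ
  structure = record
    { partition = partition
    ; e-edge    = E-edge ∘ ι
    ; e'-edge   = F-edge ∘ σ
    ; edges     = edges
    }

ind≡min⇒structure : ∀ {n} (G : Graph n) →
                    (∃[ k ] (IndMatchIs G k × MinMatchIs G k)) → ∃[ α ] ∃[ β ] ∃[ γ ] Structure G α β γ
ind≡min⇒structure G (_ , ((_ , I-induced , |I|≡k) , _) , ((_ , M-maximal , |M|≡k) , _)) =
  _ , _ , _ , StructureFromMatchings.structure G I-induced M-maximal (≤-reflexive (trans |M|≡k (sym |I|≡k)))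

structure⇒ind≡min : ∀ {n} (G : Graph n) →
                    (∃[ α ] ∃[ β ] ∃[ γ ] Structure G α β γ) → ∃[ k ] (IndMatchIs G k × MinMatchIs G k)
structure⇒ind≡min G (_ , _ , _ , S) = MatchingsFromStructure.ind≡min S

theorem2p3 : (n : ℕ) (G : Graph n) →
    ((∃[ k ] (IndMatchIs G k × MinMatchIs G k)) → ∃[ α ] ∃[ β ] ∃[ γ ] Structure G α β γ)
    × ((∃[ α ] ∃[ β ] ∃[ γ ] Structure G α β γ) → ∃[ k ] (IndMatchIs G k × MinMatchIs G k))
theorem2p3 n G = ind≡min⇒structure G , structure⇒ind≡min G
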